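{- Let $\Delta$ be a harmonious strongly shellable simplicial complex with a dimension-decreasing strong shelling order $\succ$ on $\mathcal{F}(\Delta)$. If $F_i$ is an initial facet of $\succ$, then for every facet $F_j$ with $F_i\succ F_j$, the interval $[F_i,F_j]_\succ=\{G\in\mathcal{F}(\Delta)\mid F_i\succcurlyeq G\succcurlyeq F_j\}$ generates a harmonious strongly shellable complex.
   Context: A simplicial complex is a finite family of subsets of a vertex set closed under taking subsets; $\mathcal{F}(\Delta)$ is its set of facets, $\dim(A)=|A|-1$. A linear order $F_1,\dots,F_t$ of $\mathcal{F}(\Delta)$ ($F_i\succ F_j$ iff $i<j$) is a strong shelling order if for every $1\le i<j\le t$ there exists $k$ with $1\le k<j$ such that $|F_j\setminus F_k|=1$, $F_j\setminus F_k\subseteq F_j\setminus F_i$, and $F_k\setminus F_j\subseteq F_i$; it is dimension-decreasing if $\dim F_i\ge\dim F_j$ whenever $i<j$. A facet $F$ is an initial facet of $\succ$ if $F\succ G$ for every other facet $G$ of the same dimension as $F$. For facets $F,G$, $\operatorname{dis}_\Delta(F,G)=\min(\dim F,\dim G)-\dim(F\cap G)$. The codimension one graph $\Gamma(\Delta)$ has vertex set $\mathcal{F}(\Delta)$, with $F,G$ adjacent iff $\operatorname{dis}_\Delta(F,G)=1$; $\Delta$ is harmonious if $\operatorname{dis}_\Delta(F,G)=\operatorname{dis}_{\Gamma(\Delta)}(F,G)$ (graph distance) for all facets $F,G$. -}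

module Defs where

open import Data.Nat using (ℕ; zero; suc; _≤_; _∸_; _⊓_)
open import Data.Fin using (Fin; toℕ; _<_)
open import Data.Fin.Subset using (Subset; _⊆_; _∩_; _─_; ∣_∣)
open import Data.List using (List; length; lookup; take; drop)
open import Data.List.Relation.Binary.Permutation.Propositional using (_↭_)
open import Data.Product using (Σ; _×_; ∃-syntax)
open import Relation.Binary.PropositionalEquality using (_≡_; _≢_)
open import Relation.Nullary using (¬_)

-- A simplicial complex on the vertex set Fin n is represented by the list
-- of its facets; the position in the list is a linear order on the facets,
-- F_1 ≻ F_2 ≻ ... (index i < index j  iff  F_i ≻ F_j).
-- dim A = ∣ A ∣ - 1, so comparisons of dimensions are comparisons of sizes.

module _ {n : ℕ} (L : List (Subset n)) where

  private
    F : Fin (length L) → Subset n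
    F = lookup L

  IsFacetList : Set
  IsFacetList = ∀ (i j : Fin (length L)) → i ≢ j → ¬ (F i ⊆ F j)

  IsStrongShellingOrder : Set
  IsStrongShellingOrder =
    ∀ (i j : Fin (length L)) → i < j →
      ∃[ k ] (k < j
             × ∣ F j ─ F k ∣ ≡ 1
             × (F j ─ F k) ⊆ (F j ─ F i)
             × (F k ─ F j) ⊆ F i)

  DimDecreasing : Set
  DimDecreasing = ∀ (i j : Fin (length L)) → i < j → ∣ F j ∣ ≤ ∣ F i ∣

  IsInitialFacet : Fin (length L) → Set
  IsInitialFacet i = ∀ (k : Fin (length L)) → k ≢ i → ∣ F k ∣ ≡ ∣ F i ∣ → i < k

  -- dis(F,G) = min(dim F, dim G) - dim(F ∩ G)
  --          = min(|F|,|G|) - |F ∩ G|   (always ≥ 0)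
  dis : Fin (length L) → Fin (length L) → ℕ
  dis a b = (∣ F a ∣ ⊓ ∣ F b ∣) ∸ ∣ F a ∩ F b ∣

  data Walk : Fin (length L) → Fin (length L) → ℕ → Set where
    here : ∀ {a} → Walk a a zero
    step : ∀ {a b c k} → dis a b ≡ 1 → Walk b c k → Walk a c (suc k)

  IsGraphDist : Fin (length L) → Fin (length L) → ℕ → Set
  IsGraphDist a b d = Walk a b d × (∀ k → Walk a b k → d ≤ k)

  Harmonious : Set
  Harmonious = ∀ (a b : Fin (length L)) → IsGraphDist a b (dis a b)

StronglyShellable : ∀ {n} → List (Subset n) → Set
StronglyShellable L = ∃[ L' ] (L' ↭ L × IsStrongShellingOrder L')

Interval : ∀ {n} (L : List (Subset n)) → Fin (length L) → Fin (length L) → List (Subset n)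
Interval L i j = take (suc (toℕ j ∸ toℕ i)) (drop (toℕ i) L)

module Submission where

-- A dimension-decreasing strong shelling order survives restriction to a contiguous stretch of
-- the facet list as long as, for every pair a ≻ b in the stretch, the witness c supplied by the
-- shelling lies in the stretch too.  For a prefix this is automatic.  For the suffix starting at
-- an initial facet i, a witness c ≻ i would be strictly larger than a; counting shows that then
-- dis(a,b) ≥ dis(a,c) + 2, although c and b are adjacent in Γ, contradicting harmoniousness.
-- Harmoniousness itself survives: each shelling step gives a neighbour of b strictly closer to a,
-- so there are walks of length ≤ dis, while walks in the stretch are walks in Δ, of length ≥ dis.

open import Defs
open import Data.Nat using (ℕ; zero; suc; _+_; _∸_; _⊓_; z≤n; s≤s; s≤s⁻¹)
  renaming (_≤_ to _≤ℕ_; _<_ to _<ℕ_)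
open import Data.Nat.Properties
  using ( +-suc; +-comm; ⊓-comm; +-mono-≤; +-monoʳ-≤; +-monoʳ-<; +-cancelʳ-≤; +-cancelˡ-<
        ; m≤m+n; m∸n+n≡m; m+n∸n≡m; m≥n⇒m⊓n≡n; m⊓n≤m; m⊓n≤n; ≰⇒>; m≤n⇒m<n∨m≡n
        ; ≤-refl; ≤-reflexive; ≤-trans; ≤-antisym; ≤-<-trans; <⇒≤; <⇒≱; <-asym; module ≤-Reasoning )
open import Data.Nat.Tactic.RingSolver using (solve-∀)
open import Data.Fin using (Fin; zero; suc; toℕ; _<_; _≤_; _≤?_)
open import Data.Fin.Properties using (<-cmp; toℕ-injective; <⇒≢)
open import Data.Fin.Subset using (Subset; _⊆_; _∩_; _─_; ∣_∣; _∈_; _∉_; inside; outside)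
open import Data.Fin.Subset.Properties
  using ( _∈?_; ∩-comm; x∈p∩q⁺; x∈p∩q⁻; x∈p∧x∉q⇒x∈p─q; p─q⊆p
        ; p⊆q⇒∣p∣≤∣q∣; ∣p∩q∣≤∣q∣; ∣p∩q∣≤∣p∣⊓∣q∣ )
open import Data.Vec using ([]; _∷_; here; there)
open import Data.List using (List; _∷_; length; lookup; take; drop)
open import Data.List.Relation.Binary.Permutation.Propositional using (↭-refl)
open import Data.Product using (_×_; _,_; proj₁; proj₂; ∃-syntax; map; map₂)
open import Data.Sum using (inj₁; inj₂)
open import Relation.Binary.Definitions using (tri<; tri≈; tri>)
open import Relation.Binary.PropositionalEquality
open import Relation.Nullary using (yes; no; contradiction)

∣p∣≡∣p∩q∣+∣p─q∣ : ∀ {n} (p q : Subset n) → ∣ p ∣ ≡ ∣ p ∩ q ∣ + ∣ p ─ q ∣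
∣p∣≡∣p∩q∣+∣p─q∣ []           []           = refl
∣p∣≡∣p∩q∣+∣p─q∣ (inside ∷ p)  (inside ∷ q)  = cong suc (∣p∣≡∣p∩q∣+∣p─q∣ p q)
∣p∣≡∣p∩q∣+∣p─q∣ (inside ∷ p)  (outside ∷ q) = trans (cong suc (∣p∣≡∣p∩q∣+∣p─q∣ p q)) (sym (+-suc _ _))
∣p∣≡∣p∩q∣+∣p─q∣ (outside ∷ p) (inside ∷ q)  = ∣p∣≡∣p∩q∣+∣p─q∣ p q
∣p∣≡∣p∩q∣+∣p─q∣ (outside ∷ p) (outside ∷ q) = ∣p∣≡∣p∩q∣+∣p─q∣ p q

x∈p─q⇒x∉q : ∀ {n} {x : Fin n} (p q : Subset n) → x ∈ p ─ q → x ∉ q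
x∈p─q⇒x∉q (inside ∷ p) (outside ∷ q) here ()
x∈p─q⇒x∉q (_ ∷ p) (_ ∷ q) (there x∈p─q) (there x∈q) = x∈p─q⇒x∉q p q x∈p─q x∈q

module _ {n : ℕ} where

  ShellingWitness : Subset n → Subset n → Subset n → Set
  ShellingWitness a b c = ∣ b ─ c ∣ ≡ 1 × (b ─ c) ⊆ (b ─ a) × (c ─ b) ⊆ a

  δ : Subset n → Subset n → ℕ
  δ a b = (∣ a ∣ ⊓ ∣ b ∣) ∸ ∣ a ∩ b ∣

  δ-sym : ∀ a b → δ a b ≡ δ b a
  δ-sym a b = cong₂ _∸_ (⊓-comm ∣ a ∣ ∣ b ∣) (cong ∣_∣ (∩-comm a b))

  witness-∣b∣ : ∀ {a b c} → ShellingWitness a b c → ∣ b ∣ ≡ suc ∣ b ∩ c ∣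
  witness-∣b∣ {b = b} {c} (∣b─c∣≡1 , _ , _) = begin
    ∣ b ∣                     ≡⟨ ∣p∣≡∣p∩q∣+∣p─q∣ b c ⟩
    ∣ b ∩ c ∣ + ∣ b ─ c ∣     ≡⟨ cong (∣ b ∩ c ∣ +_) ∣b─c∣≡1 ⟩
    ∣ b ∩ c ∣ + 1             ≡⟨ +-comm ∣ b ∩ c ∣ 1 ⟩
    suc ∣ b ∩ c ∣             ∎
    where open ≡-Reasoning

  witness-∩⊆ : ∀ {a b c} → ShellingWitness a b c → a ∩ b ⊆ c
  witness-∩⊆ {a} {b} {c} (_ , b─c⊆b─a , _) {x} x∈a∩b with x∈p∩q⁻ a b x∈a∩b | x ∈? c
  ... | _   , _   | yes x∈c = x∈c
  ... | x∈a , x∈b | no  x∉c =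
    contradiction x∈a (x∈p─q⇒x∉q b a (b─c⊆b─a (x∈p∧x∉q⇒x∈p─q x∈b x∉c)))

  witness-count : ∀ {a b c} → ShellingWitness a b c → ∣ a ∩ b ∣ + ∣ c ─ b ∣ ≤ℕ ∣ a ∩ c ∣
  witness-count {a} {b} {c} w@(_ , _ , c─b⊆a) = begin
    ∣ a ∩ b ∣ + ∣ c ─ b ∣              ≤⟨ +-mono-≤ (p⊆q⇒∣p∣≤∣q∣ a∩b⊆a∩c∩b) (p⊆q⇒∣p∣≤∣q∣ c─b⊆a∩c─b) ⟩
    ∣ (a ∩ c) ∩ b ∣ + ∣ (a ∩ c) ─ b ∣  ≡⟨ ∣p∣≡∣p∩q∣+∣p─q∣ (a ∩ c) b ⟨
    ∣ a ∩ c ∣                          ∎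
    where
    open ≤-Reasoning
    a∩b⊆a∩c∩b : a ∩ b ⊆ (a ∩ c) ∩ b
    a∩b⊆a∩c∩b x∈a∩b with x∈p∩q⁻ a b x∈a∩b
    ... | x∈a , x∈b = x∈p∩q⁺ (x∈p∩q⁺ (x∈a , witness-∩⊆ w x∈a∩b) , x∈b)
    c─b⊆a∩c─b : c ─ b ⊆ (a ∩ c) ─ b
    c─b⊆a∩c─b x∈c─b =
      x∈p∧x∉q⇒x∈p─q (x∈p∩q⁺ (c─b⊆a x∈c─b , p─q⊆p c b x∈c─b)) (x∈p─q⇒x∉q c b x∈c─b)

  δ-witness : ∀ {a b c} → ShellingWitness a b c → ∣ b ∣ ≤ℕ ∣ a ∣ →
              suc (δ a c + ∣ c ∣) ≤ℕ δ a b + (∣ a ∣ ⊓ ∣ c ∣)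
  δ-witness {a} {b} {c} w b≤a = +-cancelʳ-≤ ∣ a ∩ b ∣ _ _ (begin
    suc (δ a c + ∣ c ∣) + ∣ a ∩ b ∣
      ≡⟨ cong (λ t → suc (δ a c + t) + ∣ a ∩ b ∣) ∣c∣≡∣b∩c∣+∣c─b∣ ⟩
    suc (δ a c + (∣ b ∩ c ∣ + ∣ c ─ b ∣)) + ∣ a ∩ b ∣
      ≡⟨ shuffle (δ a c) (∣ b ∩ c ∣) (∣ c ─ b ∣) (∣ a ∩ b ∣) ⟩
    suc ∣ b ∩ c ∣ + (δ a c + (∣ a ∩ b ∣ + ∣ c ─ b ∣))
      ≤⟨ +-monoʳ-≤ (suc ∣ b ∩ c ∣) (+-monoʳ-≤ (δ a c) (witness-count w)) ⟩
    suc ∣ b ∩ c ∣ + (δ a c + ∣ a ∩ c ∣)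
      ≡⟨ cong₂ _+_ (sym (witness-∣b∣ w)) (m∸n+n≡m (∣p∩q∣≤∣p∣⊓∣q∣ a c)) ⟩
    ∣ b ∣ + (∣ a ∣ ⊓ ∣ c ∣)
      ≡⟨ cong (_+ (∣ a ∣ ⊓ ∣ c ∣)) δab+∣a∩b∣≡∣b∣ ⟨
    δ a b + ∣ a ∩ b ∣ + (∣ a ∣ ⊓ ∣ c ∣)
      ≡⟨ swap (δ a b) (∣ a ∩ b ∣) (∣ a ∣ ⊓ ∣ c ∣) ⟩
    δ a b + (∣ a ∣ ⊓ ∣ c ∣) + ∣ a ∩ b ∣
      ∎)
    where
    open ≤-Reasoning
    shuffle : ∀ d y z x → 1 + (d + (y + z)) + x ≡ 1 + y + (d + (x + z))
    shuffle = solve-∀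
    swap : ∀ d x m → d + x + m ≡ d + m + x
    swap = solve-∀
    ∣c∣≡∣b∩c∣+∣c─b∣ : ∣ c ∣ ≡ ∣ b ∩ c ∣ + ∣ c ─ b ∣
    ∣c∣≡∣b∩c∣+∣c─b∣ = trans (∣p∣≡∣p∩q∣+∣p─q∣ c b) (cong (λ t → ∣ t ∣ + ∣ c ─ b ∣) (∩-comm c b))
    δab+∣a∩b∣≡∣b∣ : δ a b + ∣ a ∩ b ∣ ≡ ∣ b ∣
    δab+∣a∩b∣≡∣b∣ = trans (cong (λ t → t ∸ ∣ a ∩ b ∣ + ∣ a ∩ b ∣) (m≥n⇒m⊓n≡n b≤a))
                          (m∸n+n≡m (∣p∩q∣≤∣q∣ a b))

  δ-witness≡1 : ∀ {a b c} → ShellingWitness a b c → ∣ b ∣ ≤ℕ ∣ c ∣ → δ c b ≡ 1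
  δ-witness≡1 {b = b} {c} w b≤c = begin
    (∣ c ∣ ⊓ ∣ b ∣) ∸ ∣ c ∩ b ∣  ≡⟨ cong₂ _∸_ (m≥n⇒m⊓n≡n b≤c) (cong ∣_∣ (∩-comm c b)) ⟩
    ∣ b ∣ ∸ ∣ b ∩ c ∣            ≡⟨ cong (_∸ ∣ b ∩ c ∣) (witness-∣b∣ w) ⟩
    suc ∣ b ∩ c ∣ ∸ ∣ b ∩ c ∣    ≡⟨ m+n∸n≡m 1 (∣ b ∩ c ∣) ⟩
    1                            ∎
    where open ≡-Reasoning

  δ-witness-< : ∀ {a b c} → ShellingWitness a b c → ∣ b ∣ ≤ℕ ∣ a ∣ → δ a c <ℕ δ a b
  δ-witness-< {a} {b} {c} w b≤a = +-cancelʳ-≤ ∣ c ∣ _ _ (begin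
    suc (δ a c + ∣ c ∣)        ≤⟨ δ-witness w b≤a ⟩
    δ a b + (∣ a ∣ ⊓ ∣ c ∣)    ≤⟨ +-monoʳ-≤ (δ a b) (m⊓n≤n ∣ a ∣ ∣ c ∣) ⟩
    δ a b + ∣ c ∣              ∎)
    where open ≤-Reasoning

  δ-witness-far : ∀ {a b c} → ShellingWitness a b c → ∣ b ∣ ≤ℕ ∣ a ∣ → ∣ a ∣ <ℕ ∣ c ∣ →
                  suc (δ a c) <ℕ δ a b
  δ-witness-far {a} {b} {c} w b≤a a<c = +-cancelʳ-≤ (∣ a ∣ ⊓ ∣ c ∣) _ _ (begin
    suc (suc (δ a c + (∣ a ∣ ⊓ ∣ c ∣)))  ≡⟨ cong suc (+-suc (δ a c) (∣ a ∣ ⊓ ∣ c ∣)) ⟨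
    suc (δ a c + suc (∣ a ∣ ⊓ ∣ c ∣))    ≤⟨ s≤s (+-monoʳ-≤ (δ a c) (≤-<-trans (m⊓n≤m ∣ a ∣ ∣ c ∣) a<c)) ⟩
    suc (δ a c + ∣ c ∣)                  ≤⟨ δ-witness w b≤a ⟩
    δ a b + (∣ a ∣ ⊓ ∣ c ∣)              ∎)
    where open ≤-Reasoning

record Window {A : Set} (M L : List A) : Set where
  field
    offset       : ℕ
    index        : Fin (length M) → Fin (length L)
    lookup-index : ∀ p → lookup M p ≡ lookup L (index p)
    toℕ-index    : ∀ p → toℕ (index p) ≡ offset + toℕ p
    index-onto   : ∀ x q → offset ≤ℕ toℕ x → toℕ x ≤ℕ toℕ (index q) → ∃[ p ] index p ≡ x

module _ {A : Set} where

  takeIndex : ∀ m (xs : List A) → Fin (length (take m xs)) → Fin (length xs)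
  takeIndex (suc m) (x ∷ xs) zero    = zero
  takeIndex (suc m) (x ∷ xs) (suc p) = suc (takeIndex m xs p)

  takeWindow : ∀ m (xs : List A) → Window (take m xs) xs
  takeWindow m xs = record
    { offset = 0 ; index = takeIndex m xs ; lookup-index = lookup-take m xs
    ; toℕ-index = toℕ-takeIndex m xs ; index-onto = λ x q _ → takeIndex-onto m xs x q }
    where
    lookup-take : ∀ m (xs : List A) p → lookup (take m xs) p ≡ lookup xs (takeIndex m xs p)
    lookup-take (suc m) (x ∷ xs) zero    = refl
    lookup-take (suc m) (x ∷ xs) (suc p) = lookup-take m xs p
    toℕ-takeIndex : ∀ m (xs : List A) p → toℕ (takeIndex m xs p) ≡ toℕ p
    toℕ-takeIndex (suc m) (x ∷ xs) zero    = refl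
    toℕ-takeIndex (suc m) (x ∷ xs) (suc p) = cong suc (toℕ-takeIndex m xs p)
    takeIndex-onto : ∀ m (xs : List A) x q → toℕ x ≤ℕ toℕ (takeIndex m xs q) →
                     ∃[ p ] takeIndex m xs p ≡ x
    takeIndex-onto (suc m) (y ∷ xs) zero    q       _         = zero , refl
    takeIndex-onto (suc m) (y ∷ xs) (suc x) (suc q) (s≤s x≤q) =
      map suc (cong suc) (takeIndex-onto m xs x q x≤q)

  dropIndex : ∀ d (xs : List A) → Fin (length (drop d xs)) → Fin (length xs)
  dropIndex zero    xs       p = p
  dropIndex (suc d) (x ∷ xs) p = suc (dropIndex d xs p)

  dropWindow : ∀ d (xs : List A) → Window (drop d xs) xs
  dropWindow d xs = record
    { offset = d ; index = dropIndex d xs ; lookup-index = lookup-drop d xs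
    ; toℕ-index = toℕ-dropIndex d xs ; index-onto = λ x _ d≤x _ → dropIndex-onto d xs x d≤x }
    where
    lookup-drop : ∀ d (xs : List A) p → lookup (drop d xs) p ≡ lookup xs (dropIndex d xs p)
    lookup-drop zero    xs       p = refl
    lookup-drop (suc d) (x ∷ xs) p = lookup-drop d xs p
    toℕ-dropIndex : ∀ d (xs : List A) p → toℕ (dropIndex d xs p) ≡ d + toℕ p
    toℕ-dropIndex zero    xs       p = refl
    toℕ-dropIndex (suc d) (x ∷ xs) p = cong suc (toℕ-dropIndex d xs p)
    dropIndex-onto : ∀ d (xs : List A) x → d ≤ℕ toℕ x → ∃[ p ] dropIndex d xs p ≡ x
    dropIndex-onto zero    xs       x       _         = x , refl
    dropIndex-onto (suc d) (y ∷ xs) (suc x) (s≤s d≤x) =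
      map₂ (cong suc) (dropIndex-onto d xs x d≤x)

ShortWalk : ∀ {n} (L : List (Subset n)) → Fin (length L) → Fin (length L) → Set
ShortWalk L a b = ∃[ m ] m ≤ℕ dis L a b × Walk L a b m

DisLowerBound : ∀ {n} → List (Subset n) → Set
DisLowerBound L = ∀ {a b m} → Walk L a b m → dis L a b ≤ℕ m

module _ {n : ℕ} {L : List (Subset n)} where

  dis-sym : ∀ a b → dis L a b ≡ dis L b a
  dis-sym a b = δ-sym (lookup L a) (lookup L b)

  snoc : ∀ {a b c m} → Walk L a b m → dis L b c ≡ 1 → Walk L a c (suc m)
  snoc here         b~c = step b~c here
  snoc (step a~ w)  b~c = step a~ (snoc w b~c)

  reverse : ∀ {a b m} → Walk L a b m → Walk L b a m
  reverse here                    = here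
  reverse (step {a} {b} a~b w)    = snoc (reverse w) (trans (dis-sym b a) a~b)

  harmonious⇒disLowerBound : Harmonious L → DisLowerBound L
  harmonious⇒disLowerBound harm {a} {b} {m} w = proj₂ (harm a b) m w

  disLowerBound∧shortWalks⇒harmonious : DisLowerBound L → (∀ a b → ShortWalk L a b) → Harmonious L
  disLowerBound∧shortWalks⇒harmonious lower short a b with short a b
  ... | m , m≤dis , w with ≤-antisym m≤dis (lower w)
  ...   | refl = w , λ _ → lower

  harmonious⇒dis≤1+dis : Harmonious L → ∀ {a b c} → dis L c b ≡ 1 → dis L a b ≤ℕ suc (dis L a c)
  harmonious⇒dis≤1+dis harm {a} c~b = harmonious⇒disLowerBound harm (snoc (proj₁ (harm a _)) c~b)

  module _ (dd : DimDecreasing L) (sso : IsStrongShellingOrder L) where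

    closer-neighbour : ∀ {a b} → a < b → ∃[ c ] dis L c b ≡ 1 × dis L a c <ℕ dis L a b
    closer-neighbour {a} {b} a<b with sso a b a<b
    ... | c , c<b , w = c , δ-witness≡1 w (dd c b c<b) , δ-witness-< w (dd a b a<b)

    -- Recursion on a bound d for dis: the closer neighbour may lie on either side of a.
    shortWalk-within : ∀ d a b → dis L a b ≤ℕ d → ShortWalk L a b
    shortWalk-within< : ∀ d {a b} → a < b → dis L a b ≤ℕ d → ShortWalk L a b

    shortWalk-within d a b ab≤d with <-cmp a b
    ... | tri≈ _ refl _ = 0 , z≤n , here
    ... | tri< a<b _ _  = shortWalk-within< d a<b ab≤d
    ... | tri> _ _ b<a  with shortWalk-within< d b<a (subst (_≤ℕ d) (dis-sym a b) ab≤d)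
    ...   | m , m≤dis , w = m , subst (m ≤ℕ_) (dis-sym b a) m≤dis , reverse w

    shortWalk-within< zero    a<b ab≤0 =
      contradiction (≤-trans (proj₂ (proj₂ (closer-neighbour a<b))) ab≤0) λ ()
    shortWalk-within< (suc d) a<b ab≤1+d with closer-neighbour a<b
    ... | c , c~b , ac<ab with shortWalk-within d _ c (s≤s⁻¹ (≤-trans ac<ab ab≤1+d))
    ...   | m , m≤ac , w = suc m , ≤-trans (s≤s m≤ac) ac<ab , snoc w c~b

    shortWalk : ∀ a b → ShortWalk L a b
    shortWalk a b = shortWalk-within (dis L a b) a b ≤-refl

module _ {n : ℕ} {M L : List (Subset n)} (W : Window M L) where
  open Window W

  index-mono : ∀ {p q} → p < q → index p < index q
  index-mono {p} {q} p<q = subst₂ _<ℕ_ (sym (toℕ-index p)) (sym (toℕ-index q)) (+-monoʳ-< offset p<q)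

  index-mono⁻¹ : ∀ {p q} → index p < index q → p < q
  index-mono⁻¹ {p} {q} ip<iq = +-cancelˡ-< offset _ _ (subst₂ _<ℕ_ (toℕ-index p) (toℕ-index q) ip<iq)

  offset≤index : ∀ p → offset ≤ℕ toℕ (index p)
  offset≤index p = subst (offset ≤ℕ_) (sym (toℕ-index p)) (m≤m+n offset (toℕ p))

  dis-index : ∀ p q → dis M p q ≡ dis L (index p) (index q)
  dis-index p q = cong₂ δ (lookup-index p) (lookup-index q)

  walk-index : ∀ {p q m} → Walk M p q m → Walk L (index p) (index q) m
  walk-index here                   = here
  walk-index (step {p} {q} p~q w)   = step (trans (sym (dis-index p q)) p~q) (walk-index w)

  disLowerBound-window : DisLowerBound L → DisLowerBound M
  disLowerBound-window lower {p} {q} {m} w = subst (_≤ℕ m) (sym (dis-index p q)) (lower (walk-index w))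

  dimDecreasing-window : DimDecreasing L → DimDecreasing M
  dimDecreasing-window dd p q p<q =
    subst₂ _≤ℕ_ (cong ∣_∣ (sym (lookup-index q))) (cong ∣_∣ (sym (lookup-index p)))
                (dd (index p) (index q) (index-mono p<q))

  harmonious-window : Harmonious L → DimDecreasing L → IsStrongShellingOrder M → Harmonious M
  harmonious-window harm dd sso =
    disLowerBound∧shortWalks⇒harmonious (disLowerBound-window (harmonious⇒disLowerBound harm))
                                        (shortWalk (dimDecreasing-window dd) sso)

  witness-index : ∀ {p q r} →
    ShellingWitness (lookup L (index p)) (lookup L (index q)) (lookup L (index r)) →
    ShellingWitness (lookup M p) (lookup M q) (lookup M r)
  witness-index {p} {q} {r} rewrite lookup-index p | lookup-index q | lookup-index r = λ w → w

  strongShelling-window : IsStrongShellingOrder L →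
    (∀ {a b c} → offset ≤ℕ toℕ a → a < b → c < b →
       ShellingWitness (lookup L a) (lookup L b) (lookup L c) → offset ≤ℕ toℕ c) →
    IsStrongShellingOrder M
  strongShelling-window sso witness-in-window p q p<q
    with sso (index p) (index q) (index-mono p<q)
  ... | c , c<q , w
    with index-onto c q (witness-in-window (offset≤index p) (index-mono p<q) c<q w) (<⇒≤ c<q)
  ... | r , refl = r , index-mono⁻¹ c<q , witness-index w

module _ {n : ℕ} {L : List (Subset n)} (harm : Harmonious L) (dd : DimDecreasing L)
         {i : Fin (length L)} (initial : IsInitialFacet L i) where

  larger-before-initial : ∀ {a k} → k < i → i ≤ a → ∣ lookup L a ∣ <ℕ ∣ lookup L k ∣
  larger-before-initial {a} {k} k<i i≤a = ≤-<-trans ∣a∣≤∣i∣ ∣i∣<∣k∣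
    where
    ∣a∣≤∣i∣ : ∣ lookup L a ∣ ≤ℕ ∣ lookup L i ∣
    ∣a∣≤∣i∣ with m≤n⇒m<n∨m≡n i≤a
    ... | inj₁ i<a = dd i a i<a
    ... | inj₂ i≡a = ≤-reflexive (cong (λ x → ∣ lookup L x ∣) (toℕ-injective (sym i≡a)))
    ∣i∣<∣k∣ : ∣ lookup L i ∣ <ℕ ∣ lookup L k ∣
    ∣i∣<∣k∣ with m≤n⇒m<n∨m≡n (dd k i k<i)
    ... | inj₁ ∣i∣<∣k∣ = ∣i∣<∣k∣
    ... | inj₂ ∣i∣≡∣k∣ = contradiction (initial k (<⇒≢ k<i) (sym ∣i∣≡∣k∣)) (<-asym k<i)

  witness-after-initial : ∀ {a b c} → i ≤ a → a < b → c < b →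
    ShellingWitness (lookup L a) (lookup L b) (lookup L c) → i ≤ c
  witness-after-initial {a} {b} {c} i≤a a<b c<b w with i ≤? c
  ... | yes i≤c = i≤c
  ... | no  i≰c = contradiction (harmonious⇒dis≤1+dis harm (δ-witness≡1 w (dd c b c<b)))
                    (<⇒≱ (δ-witness-far w (dd a b a<b) (larger-before-initial (≰⇒> i≰c) i≤a)))

HarmoniousDecreasingShelling : ∀ {n} → List (Subset n) → Set
HarmoniousDecreasingShelling L = Harmonious L × IsStrongShellingOrder L × DimDecreasing L

module _ {n : ℕ} {L : List (Subset n)} where

  take-harmoniousDecreasingShelling : HarmoniousDecreasingShelling L → ∀ m →
    HarmoniousDecreasingShelling (take m L)
  take-harmoniousDecreasingShelling (harm , sso , dd) m =
    harmonious-window W harm dd ssoₘ , ssoₘ , dimDecreasing-window W dd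
    where
    W = takeWindow m L
    ssoₘ = strongShelling-window W sso (λ _ _ _ _ → z≤n)

  drop-harmoniousDecreasingShelling : HarmoniousDecreasingShelling L → ∀ {i} → IsInitialFacet L i →
    HarmoniousDecreasingShelling (drop (toℕ i) L)
  drop-harmoniousDecreasingShelling (harm , sso , dd) {i} initial =
    harmonious-window W harm dd ssoᵢ , ssoᵢ , dimDecreasing-window W dd
    where
    W = dropWindow (toℕ i) L
    ssoᵢ = strongShelling-window W sso (witness-after-initial harm dd initial)

proposition3p19 : ∀ (n : ℕ) (L : List (Subset n)) →
    IsFacetList L → Harmonious L → IsStrongShellingOrder L → DimDecreasing L →
    ∀ (i j : Fin (length L)) → IsInitialFacet L i → i < j →
    Harmonious (Interval L i j) × StronglyShellable (Interval L i j)
proposition3p19 n L _ harm sso dd i j initial _ =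
  let harmᵢⱼ , ssoᵢⱼ , _ = take-harmoniousDecreasingShelling
                             (drop-harmoniousDecreasingShelling (harm , sso , dd) initial)
                             (suc (toℕ j ∸ toℕ i))
  in harmᵢⱼ , Interval L i j , ↭-refl , ssoᵢⱼ
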